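{- For any partitions $\mu\subseteq\lambda$, the skew Schur function $s_{\lambda/\mu}\in\mathsf{Sym}$ has saturated Newton polytope.
   Context: $s_{\lambda/\mu}=\sum_T x^T$ is the sum over semistandard Young tableaux $T$ of skew shape $\lambda/\mu$ (rows weakly increasing, columns strictly increasing, entries positive integers), with $x^T=\prod_i x_i^{\#\{i\text{'s in }T\}}$; it lies in the ring $\mathsf{Sym}$ of symmetric functions in $x_1,x_2,\ldots$. A polynomial $g=\sum c_\alpha x^\alpha$ has saturated Newton polytope (SNP) if every lattice point of $\mathrm{conv}\{\alpha:c_\alpha\neq0\}$ is an exponent vector with nonzero coefficient; $f\in\mathsf{Sym}$ is SNP if $f(x_1,\ldots,x_m)$ (setting $x_i=0$ for $i>m$) is SNP for every $m\geq1$.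
   Formalization: Membership in the convex hull $\mathrm{conv}\{\alpha:c_\alpha\neq0\}$ uses only convex combinations with nonnegative rational weights. -}

module Defs where

open import Data.Nat using (ℕ; zero; suc; _≤_; _<_; _≤?_)
open import Data.Nat.Properties using (_≟_)
open import Data.Fin using (Fin; toℕ)
open import Data.List using (List; []; _∷_; length; upTo; concatMap; map; filter; foldr)
open import Data.List.Relation.Unary.All using (All)
open import Data.Product using (_×_; _,_; ∃; Σ; proj₁; proj₂)
open import Data.Integer using (+_)
open import Data.Rational as ℚ using (ℚ; 0ℚ; 1ℚ)
open import Relation.Binary.PropositionalEquality using (_≡_)

-- i-th part of a partition (0-indexed), 0 beyond its length
part : List ℕ → ℕ → ℕ
part []       _       = 0
part (x ∷ xs) zero    = x
part (x ∷ xs) (suc i) = part xs i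

IsPartition : List ℕ → Set
IsPartition λ′ = All (λ x → 1 ≤ x) λ′ × (∀ i → part λ′ (suc i) ≤ part λ′ i)

_⊆ₚ_ : List ℕ → List ℕ → Set
μ ⊆ₚ λ′ = ∀ i → part μ i ≤ part λ′ i

-- (i , j) (row i, column j, 0-indexed) is a cell of the skew shape λ/μ
InSkew : List ℕ → List ℕ → ℕ → ℕ → Set
InSkew λ′ μ i j = (part μ i ≤ j) × (j < part λ′ i)

-- a filling of cells by positive integers (values off the shape are irrelevant)
Filling : Set
Filling = ℕ → ℕ → ℕ

-- semistandard Young tableau of shape λ/μ with entries in {1,…,m}
-- (i.e. the tableaux surviving the specialisation x_i = 0 for i > m)
record IsSSYT (m : ℕ) (λ′ μ : List ℕ) (T : Filling) : Set where
  field
    entries : ∀ i j → InSkew λ′ μ i j → (1 ≤ T i j) × (T i j ≤ m)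
    rows    : ∀ i j → InSkew λ′ μ i j → InSkew λ′ μ i (suc j) → T i j ≤ T i (suc j)
    cols    : ∀ i j → InSkew λ′ μ i j → InSkew λ′ μ (suc i) j → T i j < T (suc i) j

cells : List ℕ → List ℕ → List (ℕ × ℕ)
cells λ′ μ = concatMap (λ i → map (λ j → (i , j)) (filter (λ j → part μ i ≤? j) (upTo (part λ′ i))))
                       (upTo (length λ′))

multiplicity : List ℕ → List ℕ → Filling → ℕ → ℕ
multiplicity λ′ μ T k = length (filter (λ c → T (proj₁ c) (proj₂ c) ≟ k) (cells λ′ μ))

-- exponent vector of x^T in variables x_1,…,x_m
content : (m : ℕ) → List ℕ → List ℕ → Filling → (Fin m → ℕ)
content m λ′ μ T k = multiplicity λ′ μ T (suc (toℕ k))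

-- α has nonzero coefficient in s_{λ/μ}(x_1,…,x_m):
-- the coefficient is the number of SSYT of content α, so nonzero iff one exists
InSupport : (m : ℕ) → List ℕ → List ℕ → (Fin m → ℕ) → Set
InSupport m λ′ μ α = ∃ λ T → IsSSYT m λ′ μ T × (∀ k → content m λ′ μ T k ≡ α k)

ℕtoℚ : ℕ → ℚ
ℕtoℚ n = (+ n) ℚ./ 1

InConvexHull : {m : ℕ} → ((Fin m → ℕ) → Set) → (Fin m → ℕ) → Set
InConvexHull {m} S β =
  Σ (List (ℚ × (Fin m → ℕ))) λ ps →
    All (λ p → (0ℚ ℚ.≤ proj₁ p) × S (proj₂ p)) ps
    × (foldr (λ p acc → proj₁ p ℚ.+ acc) 0ℚ ps ≡ 1ℚ)
    × (∀ k → foldr (λ p acc → proj₁ p ℚ.* ℕtoℚ (proj₂ p k) ℚ.+ acc) 0ℚ ps ≡ ℕtoℚ (β k))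

SNPPoly : {m : ℕ} → ((Fin m → ℕ) → Set) → Set
SNPPoly {m} S = ∀ (β : Fin m → ℕ) → InConvexHull S β → S β

-- s_{λ/μ} ∈ Sym is SNP: s_{λ/μ}(x_1,…,x_m) is SNP for every m ≥ 1
SkewSchurSNP : List ℕ → List ℕ → Set
SkewSchurSNP λ′ μ = ∀ (m : ℕ) → 1 ≤ m → SNPPoly (InSupport m λ′ μ)

-- Writing h_j for the column heights of λ/μ, a content α is realised by a semistandard tableau
-- iff it is admissible:
--   Σ_v α_v = Σ_j h_j   and   Σ_{v ∈ S} α_v ≤ Σ_j min (h_j , |S|) for every set S of values.
-- Necessity: a column contains each value at most once. Sufficiency, by induction on the
-- number of values: put the α₁ ones on top of the α₁ tallest columns and check that the
-- remaining content is admissible for the remaining shape. Admissibility is a system of linear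
-- inequalities in α, so it passes to convex combinations: every lattice point of the Newton
-- polytope is admissible, hence lies in the support.

module Submission where

open import Algebra.Bundles using (Ring)
open import Data.Bool.Base using (Bool; true; false; if_then_else_)
open import Data.Empty using (⊥-elim)
open import Data.Fin.Base using (Fin; zero; suc; toℕ)
open import Data.Integer.Base as ℤ using (+≤+)
import Data.Integer.Properties as ℤ
open import Data.List.Base using (List; []; _∷_; _++_; length; applyUpTo; concatMap; map; filter; foldr)
open import Data.List.Properties using (filter-++; length-++)
open import Data.List.Relation.Unary.All using (All; []; _∷_)
open import Data.Nat.Base
open import Data.Nat.Properties
open import Data.Product.Base using (_×_; _,_; proj₁; proj₂; Σ; ∃; ∃₂)
open import Data.Rational.Base as ℚ using (ℚ; 0ℚ; 1ℚ; toℚᵘ)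
import Data.Rational.Properties as ℚ
open import Data.Rational.Unnormalised.Base as ℚᵘ using (ℚᵘ; mkℚᵘ; *≡*; *≤*)
import Data.Rational.Unnormalised.Properties as ℚᵘ
open import Data.Sum.Base using (_⊎_; inj₁; inj₂)
import Data.Vec.Functional as Vector
open import Function.Base using (_∘_; id)
open import Level using (0ℓ)
open import Relation.Binary.Definitions using (tri<; tri≈; tri>)
open import Relation.Binary.PropositionalEquality
open import Relation.Nullary using (Dec; yes; no; does; ¬_)
open import Relation.Nullary.Decidable using (_×-dec_; _⊎-dec_; dec-true; dec-false)
open import Relation.Unary using (Pred; Decidable)
open import Algebra.Properties.CommutativeSemigroup +-commutativeSemigroup
  using () renaming (interchange to +-interchange)
open import Algebra.Properties.Semiring.Sum +-*-semiring
  using (sum; sum-syntax; sum-cong-≗; sum-replicate-zero)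
open import Algebra.Properties.Semiring.Sum (Ring.semiring ℚ.+-*-ring) as ℚΣ
  using () renaming (sum to ∑ℚ)
open import Defs

-- Counting and summing over ℕ

χ : Bool → ℕ
χ b = if b then 1 else 0

χ≤1 : ∀ b → χ b ≤ 1
χ≤1 true  = ≤-refl
χ≤1 false = z≤n

𝟙 : {P : Set} → Dec P → ℕ
𝟙 d = χ (does d)

module _ {P : Set} where

  𝟙-yes : (d : Dec P) → P → 𝟙 d ≡ 1
  𝟙-yes (yes _) _ = refl
  𝟙-yes (no ¬p) p = ⊥-elim (¬p p)

  𝟙-no : (d : Dec P) → ¬ P → 𝟙 d ≡ 0
  𝟙-no (yes p) ¬p = ⊥-elim (¬p p)
  𝟙-no (no _)  _  = refl

  𝟙≤1 : (d : Dec P) → 𝟙 d ≤ 1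
  𝟙≤1 d = χ≤1 (does d)

𝟙-≤ : {P : Set} {x : ℕ} → (P → 1 ≤ x) → (d : Dec P) → 𝟙 d ≤ x
𝟙-≤ p⇒1≤x (yes p) = p⇒1≤x p
𝟙-≤ _     (no _)  = z≤n

𝟙-mono : {P Q : Set} → (P → Q) → (d : Dec P) (e : Dec Q) → 𝟙 d ≤ 𝟙 e
𝟙-mono f (yes p) e = ≤-reflexive (sym (𝟙-yes e (f p)))
𝟙-mono f (no _)  _ = z≤n

𝟙-cong : {P Q : Set} → (P → Q) → (Q → P) → (d : Dec P) (e : Dec Q) → 𝟙 d ≡ 𝟙 e
𝟙-cong f g d e = ≤-antisym (𝟙-mono f d e) (𝟙-mono g e d)

module _ {P Q : Set} where

  𝟙-× : (d : Dec P) (e : Dec Q) → 𝟙 (d ×-dec e) ≡ 𝟙 d * 𝟙 e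
  𝟙-× (yes _) (yes _) = refl
  𝟙-× (yes _) (no _)  = refl
  𝟙-× (no _)  _       = refl

  𝟙-⊎≤ : (d : Dec P) (e : Dec Q) → 𝟙 (d ⊎-dec e) ≤ 𝟙 d + 𝟙 e
  𝟙-⊎≤ (yes _) _ = s≤s z≤n
  𝟙-⊎≤ (no _)  e = ≤-refl

_·_ : ∀ {m} → (Fin m → ℕ) → (Fin m → ℕ) → ℕ
w · α = sum (λ v → w v * α v)

-- ℕ's _≟_ is decided by a builtin test that reduces on suc, so the indicators simplify by computation.
sum-𝟙-≟-suc-toℕ : ∀ {m} x → 1 ≤ x → x ≤ m → sum {m} (λ u → 𝟙 (x ≟ suc (toℕ u))) ≡ 1
sum-𝟙-≟-suc-toℕ {suc m} 1             _ _         = cong suc (sum-replicate-zero m)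
sum-𝟙-≟-suc-toℕ {suc m} (suc (suc x)) _ (s≤s x<m) = sum-𝟙-≟-suc-toℕ (suc x) z<s x<m

sum-mono-≤ : ∀ {n} {f g : Fin n → ℕ} → (∀ i → f i ≤ g i) → sum f ≤ sum g
sum-mono-≤ {zero}  _   = z≤n
sum-mono-≤ {suc n} f≤g = +-mono-≤ (f≤g _) (sum-mono-≤ (f≤g ∘ suc))

∑< : ℕ → (ℕ → ℕ) → ℕ
∑< zero    f = 0
∑< (suc n) f = f 0 + ∑< n (f ∘ suc)

∑<-cong : ∀ n {f g : ℕ → ℕ} → (∀ i → i < n → f i ≡ g i) → ∑< n f ≡ ∑< n g
∑<-cong zero    _   = refl
∑<-cong (suc n) f≡g = cong₂ _+_ (f≡g 0 z<s) (∑<-cong n (λ i i<n → f≡g (suc i) (s<s i<n)))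

∑<-mono-≤ : ∀ n {f g : ℕ → ℕ} → (∀ i → i < n → f i ≤ g i) → ∑< n f ≤ ∑< n g
∑<-mono-≤ zero    _   = z≤n
∑<-mono-≤ (suc n) f≤g = +-mono-≤ (f≤g 0 z<s) (∑<-mono-≤ n (λ i i<n → f≤g (suc i) (s<s i<n)))

∑<-zero : ∀ n {f : ℕ → ℕ} → (∀ i → i < n → f i ≡ 0) → ∑< n f ≡ 0
∑<-zero zero    _   = refl
∑<-zero (suc n) f≡0 = cong₂ _+_ (f≡0 0 z<s) (∑<-zero n (λ i i<n → f≡0 (suc i) (s<s i<n)))

∑<≡0⇒ : ∀ n {f : ℕ → ℕ} → ∑< n f ≡ 0 → ∀ {i} → i < n → f i ≡ 0
∑<≡0⇒ (suc n) {f} ∑≡0 {zero}  _         = m+n≡0⇒m≡0 (f 0) ∑≡0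
∑<≡0⇒ (suc n) {f} ∑≡0 {suc i} (s≤s i<n) = ∑<≡0⇒ n (m+n≡0⇒n≡0 (f 0) ∑≡0) i<n

∑<-distrib-+ : ∀ n (f g : ℕ → ℕ) → ∑< n (λ i → f i + g i) ≡ ∑< n f + ∑< n g
∑<-distrib-+ zero    f g = refl
∑<-distrib-+ (suc n) f g = trans (cong (f 0 + g 0 +_) (∑<-distrib-+ n (f ∘ suc) (g ∘ suc)))
                                 (+-interchange (f 0) (g 0) _ _)

*-distribˡ-∑< : ∀ n x (f : ℕ → ℕ) → x * ∑< n f ≡ ∑< n (λ i → x * f i)
*-distribˡ-∑< zero    x f = *-zeroʳ x
*-distribˡ-∑< (suc n) x f =
  trans (*-distribˡ-+ x (f 0) _) (cong (x * f 0 +_) (*-distribˡ-∑< n x (f ∘ suc)))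

∑<-comm : ∀ m n (f : ℕ → ℕ → ℕ) → ∑< m (λ i → ∑< n (f i)) ≡ ∑< n (λ j → ∑< m (λ i → f i j))
∑<-comm zero    n f = sym (∑<-zero n (λ _ _ → refl))
∑<-comm (suc m) n f = trans (cong (∑< n (f 0) +_) (∑<-comm m n (f ∘ suc)))
                            (sym (∑<-distrib-+ n (f 0) _))

sum-∑<-comm : ∀ {m} n (f : Fin m → ℕ → ℕ) → sum (λ v → ∑< n (f v)) ≡ ∑< n (λ j → sum (λ v → f v j))
sum-∑<-comm {zero}  n f = sym (∑<-zero n (λ _ _ → refl))
sum-∑<-comm {suc m} n f = trans (cong (∑< n (f zero) +_) (sum-∑<-comm n (f ∘ suc)))
                                (sym (∑<-distrib-+ n (f zero) _))

∑<-𝟙-≤1 : ∀ n {P : ℕ → Set} (P? : Decidable P) → (∀ {i i′} → P i → P i′ → i ≡ i′) →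
          ∑< n (𝟙 ∘ P?) ≤ 1
∑<-𝟙-≤1 zero    P? _      = z≤n
∑<-𝟙-≤1 (suc n) P? unique with P? 0
... | no _   = ∑<-𝟙-≤1 n (P? ∘ suc) (λ p p′ → suc-injective (unique p p′))
... | yes p₀ =
  ≤-reflexive (cong suc (∑<-zero n (λ i _ → 𝟙-no (P? (suc i)) (λ p → 0≢1+n (unique p₀ p)))))

∑<-extend : ∀ n C (f : ℕ → ℕ) → n ≤ C → ∑< n f ≡ ∑< C (λ j → 𝟙 (j <? n) * f j)
∑<-extend zero    C       f _         = sym (∑<-zero C (λ _ _ → refl))
∑<-extend (suc n) (suc C) f (s≤s n≤C) = cong₂ _+_ (sym (+-identityʳ (f 0)))
  (trans (∑<-extend n C (f ∘ suc) n≤C)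
         (∑<-cong C (λ j _ → cong (_* f (suc j)) (𝟙-cong s≤s s≤s⁻¹ (j <? n) (suc j <? suc n)))))

∑<-interval : ∀ R a b → b ≤ R → ∑< R (λ i → 𝟙 (a ≤? i ×-dec i <? b)) ≡ b ∸ a
∑<-interval R a zero _ =
  trans (∑<-zero R (λ i _ → 𝟙-no (a ≤? i ×-dec i <? 0) (λ ()))) (sym (0∸n≡0 a))
∑<-interval zero _ (suc _) ()
∑<-interval (suc R) zero (suc b) (s≤s b≤R) =
  cong suc (trans (∑<-cong R (λ i _ → shift i)) (∑<-interval R zero b b≤R))
  where
  shift : ∀ i → 𝟙 (0 ≤? suc i ×-dec suc i <? suc b) ≡ 𝟙 (0 ≤? i ×-dec i <? b)
  shift i = 𝟙-cong (λ { (_ , s≤s i<b) → z≤n , i<b }) (λ { (_ , i<b) → z≤n , s≤s i<b })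
                     (0 ≤? suc i ×-dec suc i <? suc b) (0 ≤? i ×-dec i <? b)
∑<-interval (suc R) (suc a) (suc b) (s≤s b≤R) =
  trans (∑<-cong R (λ i _ → shift i)) (∑<-interval R a b b≤R)
  where
  shift : ∀ i → 𝟙 (suc a ≤? suc i ×-dec suc i <? suc b) ≡ 𝟙 (a ≤? i ×-dec i <? b)
  shift i = 𝟙-cong (λ { (s≤s a≤i , s≤s i<b) → a≤i , i<b }) (λ { (a≤i , i<b) → s≤s a≤i , s≤s i<b })
                     (suc a ≤? suc i ×-dec suc i <? suc b) (a ≤? i ×-dec i <? b)

∀<⇒≤ : ∀ {a b} → (∀ {i} → i < a → i < b) → a ≤ b
∀<⇒≤ {a} {b} <a⇒<b = ≮⇒≥ (λ b<a → <-irrefl refl (<a⇒<b b<a))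

⊓-suc-pred : ∀ {x} k → 1 ≤ x → x ⊓ suc k ≡ (x ∸ 1) ⊓ k + 1
⊓-suc-pred {suc x} k _ = +-comm 1 (x ⊓ k)

⊓-pred : ∀ {x k} → k < x → x ⊓ k ≡ (x ∸ 1) ⊓ k
⊓-pred {suc x} (s≤s k≤x) = trans (m≥n⇒m⊓n≡n (m≤n⇒m≤1+n k≤x)) (sym (m≥n⇒m⊓n≡n k≤x))

stepwise-intermediate-value : (g : ℕ → ℕ) → (∀ p → g (suc p) ≤ suc (g p)) →
                              ∀ N {a} → g 0 ≤ a → a ≤ g N → ∃ λ p → g p ≡ a
stepwise-intermediate-value g step zero    g0≤a a≤gN = 0 , ≤-antisym g0≤a a≤gN
stepwise-intermediate-value g step (suc N) {a} g0≤a a≤gN with a ≤? g N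
... | yes a≤gN′ = stepwise-intermediate-value g step N g0≤a a≤gN′
... | no  a≰gN′ = suc N , ≤-antisym (≤-trans (step N) (≰⇒> a≰gN′)) a≤gN

antitone-crossing : (h : ℕ → ℕ) → (∀ t → h (suc t) ≤ h t) →
                    ∀ n {t₀ a} → a ≤ h t₀ → h (n + t₀) ≤ a → ∃ λ t → t₀ ≤ t × a ≤ h t × h (suc t) ≤ a
antitone-crossing h anti zero    {t₀} a≤h hn≤a = t₀ , ≤-refl , a≤h , ≤-trans (anti t₀) hn≤a
antitone-crossing h anti (suc n) {t₀} {a} a≤h hn≤a with h (suc t₀) ≤? a
... | yes h≤a = t₀ , ≤-refl , a≤h , h≤a
... | no  h≰a
  with antitone-crossing h anti n (<⇒≤ (≰⇒> h≰a)) (subst (λ s → h s ≤ a) (sym (+-suc n t₀)) hn≤a)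
...   | t , t₀<t , crossing = t , <⇒≤ t₀<t , crossing

module _ {A : Set} {P : Pred A 0ℓ} (P? : Decidable P) where

  length-filter-++ : ∀ xs ys →
                     length (filter P? (xs ++ ys)) ≡ length (filter P? xs) + length (filter P? ys)
  length-filter-++ xs ys = trans (cong length (filter-++ P? xs ys)) (length-++ (filter P? xs))

  length-filter-concatMap-applyUpTo : ∀ (g : ℕ → List A) f n →
    length (filter P? (concatMap g (applyUpTo f n))) ≡ ∑< n (λ i → length (filter P? (g (f i))))
  length-filter-concatMap-applyUpTo g f zero    = refl
  length-filter-concatMap-applyUpTo g f (suc n) =
    trans (length-filter-++ (g (f 0)) _)
          (cong (length (filter P? (g (f 0))) +_) (length-filter-concatMap-applyUpTo g (f ∘ suc) n))

  length-filter-map : ∀ {B : Set} (h : B → A) xs →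
                      length (filter P? (map h xs)) ≡ length (filter (P? ∘ h) xs)
  length-filter-map h []       = refl
  length-filter-map h (x ∷ xs) with does (P? (h x))
  ... | true  = cong suc (length-filter-map h xs)
  ... | false = length-filter-map h xs

length-filter-filter-applyUpTo : ∀ {P Q : Pred ℕ 0ℓ} (P? : Decidable P) (Q? : Decidable Q) f n →
  length (filter Q? (filter P? (applyUpTo f n))) ≡ ∑< n (λ j → 𝟙 (P? (f j) ×-dec Q? (f j)))
length-filter-filter-applyUpTo P? Q? f zero = refl
length-filter-filter-applyUpTo P? Q? f (suc n) with P? (f 0)
... | no _ = length-filter-filter-applyUpTo P? Q? (f ∘ suc) n
... | yes _ with Q? (f 0)
...   | yes _ = cong suc (length-filter-filter-applyUpTo P? Q? (f ∘ suc) n)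
...   | no  _ = length-filter-filter-applyUpTo P? Q? (f ∘ suc) n

-- Linear inequalities on convex hulls

private
  fromℕᵘ : ℕ → ℚᵘ
  fromℕᵘ n = mkℚᵘ (ℤ.+ n) 0

  toℚᵘ-ℕtoℚ : ∀ n → toℚᵘ (ℕtoℚ n) ℚᵘ.≃ fromℕᵘ n
  toℚᵘ-ℕtoℚ n = ℚ.toℚᵘ-fromℚᵘ (fromℕᵘ n)

  fromℕᵘ-+ : ∀ a b → fromℕᵘ (a + b) ℚᵘ.≃ fromℕᵘ a ℚᵘ.+ fromℕᵘ b
  fromℕᵘ-+ a b = *≡* (cong (ℤ._* ℤ.1ℤ)
    (trans (ℤ.pos-+ a b) (sym (cong₂ ℤ._+_ (ℤ.*-identityʳ (ℤ.+ a)) (ℤ.*-identityʳ (ℤ.+ b))))))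

  fromℕᵘ-* : ∀ a b → fromℕᵘ (a * b) ℚᵘ.≃ fromℕᵘ a ℚᵘ.* fromℕᵘ b
  fromℕᵘ-* a b = *≡* (cong (ℤ._* ℤ.1ℤ) (ℤ.pos-* a b))

ℕtoℚ-+ : ∀ a b → ℕtoℚ (a + b) ≡ ℕtoℚ a ℚ.+ ℕtoℚ b
ℕtoℚ-+ a b = ℚ.toℚᵘ-injective (begin
  toℚᵘ (ℕtoℚ (a + b))                      ≈⟨ toℚᵘ-ℕtoℚ (a + b) ⟩
  fromℕᵘ (a + b)                           ≈⟨ fromℕᵘ-+ a b ⟩
  fromℕᵘ a ℚᵘ.+ fromℕᵘ b                   ≈⟨ ℚᵘ.+-cong (toℚᵘ-ℕtoℚ a) (toℚᵘ-ℕtoℚ b) ⟨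
  toℚᵘ (ℕtoℚ a) ℚᵘ.+ toℚᵘ (ℕtoℚ b)         ≈⟨ ℚ.toℚᵘ-homo-+ (ℕtoℚ a) (ℕtoℚ b) ⟨
  toℚᵘ (ℕtoℚ a ℚ.+ ℕtoℚ b)                 ∎)
  where open ℚᵘ.≃-Reasoning

ℕtoℚ-* : ∀ a b → ℕtoℚ (a * b) ≡ ℕtoℚ a ℚ.* ℕtoℚ b
ℕtoℚ-* a b = ℚ.toℚᵘ-injective (begin
  toℚᵘ (ℕtoℚ (a * b))                      ≈⟨ toℚᵘ-ℕtoℚ (a * b) ⟩
  fromℕᵘ (a * b)                           ≈⟨ fromℕᵘ-* a b ⟩
  fromℕᵘ a ℚᵘ.* fromℕᵘ b                   ≈⟨ ℚᵘ.*-cong (toℚᵘ-ℕtoℚ a) (toℚᵘ-ℕtoℚ b) ⟨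
  toℚᵘ (ℕtoℚ a) ℚᵘ.* toℚᵘ (ℕtoℚ b)         ≈⟨ ℚ.toℚᵘ-homo-* (ℕtoℚ a) (ℕtoℚ b) ⟨
  toℚᵘ (ℕtoℚ a ℚ.* ℕtoℚ b)                 ∎)
  where open ℚᵘ.≃-Reasoning

ℕtoℚ-cancel-≤ : ∀ {a b} → ℕtoℚ a ℚ.≤ ℕtoℚ b → a ≤ b
ℕtoℚ-cancel-≤ {a} {b} a≤b
  with ℚᵘ.≤-respʳ-≃ (toℚᵘ-ℕtoℚ b) (ℚᵘ.≤-respˡ-≃ (toℚᵘ-ℕtoℚ a) (ℚ.toℚᵘ-mono-≤ a≤b))
... | *≤* a1≤b1 with subst₂ ℤ._≤_ (ℤ.*-identityʳ (ℤ.+ a)) (ℤ.*-identityʳ (ℤ.+ b)) a1≤b1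
...   | +≤+ a≤b′ = a≤b′

ℕtoℚ-mono-≤ : ∀ {a b} → a ≤ b → ℕtoℚ a ℚ.≤ ℕtoℚ b
ℕtoℚ-mono-≤ {a} {b} a≤b = ℚ.toℚᵘ-cancel-≤
  (ℚᵘ.≤-respʳ-≃ (ℚᵘ.≃-sym (toℚᵘ-ℕtoℚ b)) (ℚᵘ.≤-respˡ-≃ (ℚᵘ.≃-sym (toℚᵘ-ℕtoℚ a))
    (*≤* (ℤ.*-monoʳ-≤-nonNeg ℤ.1ℤ (+≤+ a≤b)))))

ℕtoℚ-injective : ∀ {a b} → ℕtoℚ a ≡ ℕtoℚ b → a ≡ b
ℕtoℚ-injective a≡b =
  ≤-antisym (ℕtoℚ-cancel-≤ (ℚ.≤-reflexive a≡b)) (ℕtoℚ-cancel-≤ (ℚ.≤-reflexive (sym a≡b)))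

ℕtoℚ-sum : ∀ {m} (f : Fin m → ℕ) → ℕtoℚ (sum f) ≡ ∑ℚ (ℕtoℚ ∘ f)
ℕtoℚ-sum {zero}  f = refl
ℕtoℚ-sum {suc m} f = trans (ℕtoℚ-+ (f zero) _) (cong (ℕtoℚ (f zero) ℚ.+_) (ℕtoℚ-sum (f ∘ suc)))

module _ {m : ℕ} where

  ℕtoℚ-· : ∀ (w α : Fin m → ℕ) → ℕtoℚ (w · α) ≡ ∑ℚ (λ v → ℕtoℚ (w v) ℚ.* ℕtoℚ (α v))
  ℕtoℚ-· w α = trans (ℕtoℚ-sum (λ v → w v * α v)) (ℚΣ.sum-cong-≗ (λ v → ℕtoℚ-* (w v) (α v)))

  totalWeight : List (ℚ × (Fin m → ℕ)) → ℚ
  totalWeight = foldr (λ p acc → proj₁ p ℚ.+ acc) 0ℚ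

  combine : ((Fin m → ℕ) → ℕ) → List (ℚ × (Fin m → ℕ)) → ℚ
  combine f = foldr (λ p acc → proj₁ p ℚ.* ℕtoℚ (f (proj₂ p)) ℚ.+ acc) 0ℚ

  NonNegativeOn : ((Fin m → ℕ) → Set) → List (ℚ × (Fin m → ℕ)) → Set
  NonNegativeOn S = All (λ p → (0ℚ ℚ.≤ proj₁ p) × S (proj₂ p))

  module _ {S : (Fin m → ℕ) → Set} {f g : (Fin m → ℕ) → ℕ} where

    combine-cong : (∀ α → S α → f α ≡ g α) →
                   ∀ {ps} → NonNegativeOn S ps → combine f ps ≡ combine g ps
    combine-cong f≡g []                   = refl
    combine-cong f≡g {(c , α) ∷ _} ((_ , sα) ∷ nonneg) =
      cong₂ (λ x y → c ℚ.* ℕtoℚ x ℚ.+ y) (f≡g α sα) (combine-cong f≡g nonneg)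

    combine-mono-≤ : (∀ α → S α → f α ≤ g α) →
                     ∀ {ps} → NonNegativeOn S ps → combine f ps ℚ.≤ combine g ps
    combine-mono-≤ f≤g []                        = ℚ.≤-refl
    combine-mono-≤ f≤g {(c , α) ∷ _} ((0≤c , sα) ∷ nonneg) =
      ℚ.+-mono-≤ (ℚ.*-monoˡ-≤-nonNeg c {{ℚ.nonNegative 0≤c}} (ℕtoℚ-mono-≤ (f≤g α sα)))
                 (combine-mono-≤ f≤g nonneg)

  combine-const : ∀ B ps → combine (λ _ → B) ps ≡ ℕtoℚ B ℚ.* totalWeight ps
  combine-const B []            = sym (ℚ.*-zeroʳ (ℕtoℚ B))
  combine-const B ((c , _) ∷ ps) = begin
    c ℚ.* ℕtoℚ B ℚ.+ combine (λ _ → B) ps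
      ≡⟨ cong₂ ℚ._+_ (ℚ.*-comm c (ℕtoℚ B)) (combine-const B ps) ⟩
    ℕtoℚ B ℚ.* c ℚ.+ ℕtoℚ B ℚ.* totalWeight ps
      ≡⟨ ℚ.*-distribˡ-+ (ℕtoℚ B) c (totalWeight ps) ⟨
    ℕtoℚ B ℚ.* (c ℚ.+ totalWeight ps) ∎
    where open ≡-Reasoning

  combine-· : ∀ (w : Fin m → ℕ) ps → combine (w ·_) ps ≡ ∑ℚ (λ v → ℕtoℚ (w v) ℚ.* combine (λ α → α v) ps)
  combine-· w [] = sym (trans (ℚΣ.sum-cong-≗ (λ v → ℚ.*-zeroʳ (ℕtoℚ (w v)))) (ℚΣ.sum-replicate-zero m))
  combine-· w ((c , α) ∷ ps) = begin
    c ℚ.* ℕtoℚ (w · α) ℚ.+ combine (w ·_) ps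
      ≡⟨ cong₂ (λ x y → c ℚ.* x ℚ.+ y) (ℕtoℚ-· w α) (combine-· w ps) ⟩
    c ℚ.* ∑ℚ (λ v → W v ℚ.* A v) ℚ.+ ∑ℚ (λ v → W v ℚ.* X v)
      ≡⟨ cong (ℚ._+ ∑ℚ (λ v → W v ℚ.* X v)) (ℚΣ.*-distribˡ-sum c (λ v → W v ℚ.* A v)) ⟩
    ∑ℚ (λ v → c ℚ.* (W v ℚ.* A v)) ℚ.+ ∑ℚ (λ v → W v ℚ.* X v)
      ≡⟨ ℚΣ.∑-distrib-+ (λ v → c ℚ.* (W v ℚ.* A v)) (λ v → W v ℚ.* X v) ⟨
    ∑ℚ (λ v → c ℚ.* (W v ℚ.* A v) ℚ.+ W v ℚ.* X v)
      ≡⟨ ℚΣ.sum-cong-≗ (λ v → regroup (W v) (A v) (X v)) ⟩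
    ∑ℚ (λ v → W v ℚ.* (c ℚ.* A v ℚ.+ X v)) ∎
    where
    open ≡-Reasoning
    W A X : Fin m → ℚ
    W v = ℕtoℚ (w v)
    A v = ℕtoℚ (α v)
    X v = combine (λ α → α v) ps
    regroup : ∀ x a r → c ℚ.* (x ℚ.* a) ℚ.+ x ℚ.* r ≡ x ℚ.* (c ℚ.* a ℚ.+ r)
    regroup x a r = begin
      c ℚ.* (x ℚ.* a) ℚ.+ x ℚ.* r   ≡⟨ cong (ℚ._+ x ℚ.* r) (ℚ.*-assoc c x a) ⟨
      c ℚ.* x ℚ.* a ℚ.+ x ℚ.* r     ≡⟨ cong (λ y → y ℚ.* a ℚ.+ x ℚ.* r) (ℚ.*-comm c x) ⟩
      x ℚ.* c ℚ.* a ℚ.+ x ℚ.* r     ≡⟨ cong (ℚ._+ x ℚ.* r) (ℚ.*-assoc x c a) ⟩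
      x ℚ.* (c ℚ.* a) ℚ.+ x ℚ.* r   ≡⟨ ℚ.*-distribˡ-+ x (c ℚ.* a) r ⟨
      x ℚ.* (c ℚ.* a ℚ.+ r)         ∎

  ℕtoℚ-·-combination : ∀ (w : Fin m → ℕ) {β} ps → (∀ k → combine (λ α → α k) ps ≡ ℕtoℚ (β k)) →
                       ℕtoℚ (w · β) ≡ combine (w ·_) ps
  ℕtoℚ-·-combination w {β} ps coords = begin
    ℕtoℚ (w · β)
      ≡⟨ ℕtoℚ-· w β ⟩
    ∑ℚ (λ v → ℕtoℚ (w v) ℚ.* ℕtoℚ (β v))
      ≡⟨ ℚΣ.sum-cong-≗ (λ v → cong (ℕtoℚ (w v) ℚ.*_) (coords v)) ⟨
    ∑ℚ (λ v → ℕtoℚ (w v) ℚ.* combine (λ α → α v) ps)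
      ≡⟨ combine-· w ps ⟨
    combine (w ·_) ps ∎
    where open ≡-Reasoning

  module _ {S : (Fin m → ℕ) → Set} (w : Fin m → ℕ) (B : ℕ) where

    ·-≤-convexHull : (∀ α → S α → w · α ≤ B) → ∀ {β} → InConvexHull S β → w · β ≤ B
    ·-≤-convexHull w·α≤B {β} (ps , nonneg , weight≡1 , coords) = ℕtoℚ-cancel-≤ (begin
      ℕtoℚ (w · β)                ≡⟨ ℕtoℚ-·-combination w ps coords ⟩
      combine (w ·_) ps           ≤⟨ combine-mono-≤ w·α≤B nonneg ⟩
      combine (λ _ → B) ps        ≡⟨ combine-const B ps ⟩
      ℕtoℚ B ℚ.* totalWeight ps   ≡⟨ cong (ℕtoℚ B ℚ.*_) weight≡1 ⟩
      ℕtoℚ B ℚ.* 1ℚ               ≡⟨ ℚ.*-identityʳ (ℕtoℚ B) ⟩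
      ℕtoℚ B                      ∎)
      where open ℚ.≤-Reasoning

    ·-≡-convexHull : (∀ α → S α → w · α ≡ B) → ∀ {β} → InConvexHull S β → w · β ≡ B
    ·-≡-convexHull w·α≡B {β} (ps , nonneg , weight≡1 , coords) = ℕtoℚ-injective (begin
      ℕtoℚ (w · β)                ≡⟨ ℕtoℚ-·-combination w ps coords ⟩
      combine (w ·_) ps           ≡⟨ combine-cong w·α≡B nonneg ⟩
      combine (λ _ → B) ps        ≡⟨ combine-const B ps ⟩
      ℕtoℚ B ℚ.* totalWeight ps   ≡⟨ cong (ℕtoℚ B ℚ.*_) weight≡1 ⟩
      ℕtoℚ B ℚ.* 1ℚ               ≡⟨ ℚ.*-identityʳ (ℕtoℚ B) ⟩
      ℕtoℚ B                      ∎)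
      where open ≡-Reasoning

-- Conjugate partitions

record Decreasing (l : List ℕ) : Set where
  constructor decreasing
  field part-anti : ∀ i → part l (suc i) ≤ part l i

decreasing-tail : ∀ {x xs} → Decreasing (x ∷ xs) → Decreasing xs
decreasing-tail (decreasing anti) = decreasing (anti ∘ suc)

part≤head : ∀ {l} → Decreasing l → ∀ i → part l i ≤ part l 0
part≤head _   zero    = ≤-refl
part≤head dec (suc i) = ≤-trans (Decreasing.part-anti dec i) (part≤head dec i)

conjugate : List ℕ → ℕ → ℕ
conjugate []       j = 0
conjugate (x ∷ xs) j = 𝟙 (j <? x) + conjugate xs j

conjugate≤length : ∀ l j → conjugate l j ≤ length l
conjugate≤length []       j = z≤n
conjugate≤length (x ∷ xs) j = +-mono-≤ (𝟙≤1 (j <? x)) (conjugate≤length xs j)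

conjugate-∷-< : ∀ {x} xs {j} → j < x → conjugate (x ∷ xs) j ≡ suc (conjugate xs j)
conjugate-∷-< {x} xs {j} j<x = cong (_+ conjugate xs j) (𝟙-yes (j <? x) j<x)

conjugate-∷-≮ : ∀ {x} xs {j} → ¬ j < x → conjugate (x ∷ xs) j ≡ conjugate xs j
conjugate-∷-≮ {x} xs {j} j≮x = cong (_+ conjugate xs j) (𝟙-no (j <? x) j≮x)

<part⇒<conjugate : ∀ {l} → Decreasing l → ∀ {i j} → j < part l i → i < conjugate l j
<part⇒<conjugate {x ∷ xs} dec {zero}  {j} j<x    = subst (0 <_) (sym (conjugate-∷-< xs j<x)) z<s
<part⇒<conjugate {x ∷ xs} dec {suc i} {j} j<part = subst (suc i <_) (sym (conjugate-∷-< xs j<x))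
  (s<s (<part⇒<conjugate (decreasing-tail dec) j<part))
  where
  j<x : j < x
  j<x = <-≤-trans j<part (part≤head dec (suc i))

<conjugate⇒<part : ∀ {l} → Decreasing l → ∀ {i j} → i < conjugate l j → j < part l i
<conjugate⇒<part {x ∷ xs} dec {i} {j} i<c with j <? x
<conjugate⇒<part {x ∷ xs} dec {i}     {j} i<c  | no j≮x =
  ⊥-elim (j≮x (<-≤-trans
    (<conjugate⇒<part (decreasing-tail dec) (subst (i <_) (conjugate-∷-≮ xs j≮x) i<c))
    (part≤head dec (suc i))))
<conjugate⇒<part {x ∷ xs} dec {zero}  {j} _    | yes j<x = j<x
<conjugate⇒<part {x ∷ xs} dec {suc i} {j} si<c | yes j<x =
  <conjugate⇒<part (decreasing-tail dec) (s≤s⁻¹ (subst (suc i <_) (conjugate-∷-< xs j<x) si<c))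

module _ {l : List ℕ} (dec : Decreasing l) where

  conjugate-anti : ∀ j → conjugate l (suc j) ≤ conjugate l j
  conjugate-anti j = ∀<⇒≤ (λ i<c → <part⇒<conjugate dec (<-trans (n<1+n j) (<conjugate⇒<part dec i<c)))

  conjugate-beyond : ∀ {j} → part l 0 ≤ j → conjugate l j ≡ 0
  conjugate-beyond {j} head≤j = n≤0⇒n≡0 (∀<⇒≤ λ {i} i<c →
    ⊥-elim (<⇒≱ (<-≤-trans (<conjugate⇒<part dec i<c) (part≤head dec i)) head≤j))

conjugate-mono-⊆ : ∀ {μ l} → Decreasing μ → Decreasing l → μ ⊆ₚ l → ∀ j → conjugate μ j ≤ conjugate l j
conjugate-mono-⊆ decμ decl μ⊆l j =
  ∀<⇒≤ (λ {i} i<c → <part⇒<conjugate decl (<-≤-trans (<conjugate⇒<part decμ i<c) (μ⊆l i)))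

-- Column-strict fillings

-- The lower boundary is fixed; the upper boundary top varies, as peeling off the ones lowers it.
module ColumnShape
  (bottom : ℕ → ℕ) (R C : ℕ)
  (bottom-anti : ∀ j → bottom (suc j) ≤ bottom j)
  (bottom≤R : ∀ j → bottom j ≤ R)
  (bottom-beyond : ∀ {j} → C ≤ j → bottom j ≡ 0)
  where

  InColumn : (ℕ → ℕ) → ℕ → ℕ → Set
  InColumn top i j = top j ≤ i × i < bottom j

  inColumn? : ∀ top i j → Dec (InColumn top i j)
  inColumn? top i j = top j ≤? i ×-dec i <? bottom j

  height : (ℕ → ℕ) → ℕ → ℕ
  height top j = bottom j ∸ top j

  record ColumnStrict (m : ℕ) (top : ℕ → ℕ) (T : Filling) : Set where
    field
      entries : ∀ {i j} → InColumn top i j → 1 ≤ T i j × T i j ≤ m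
      rows    : ∀ {i j} → InColumn top i j → InColumn top i (suc j) → T i j ≤ T i (suc j)
      cols    : ∀ {i j} → InColumn top i j → InColumn top (suc i) j → T i j < T (suc i) j

  columnOccurrences : (ℕ → ℕ) → Filling → ℕ → ℕ → ℕ
  columnOccurrences top T v j = ∑< R (λ i → 𝟙 (inColumn? top i j ×-dec T i j ≟ v))

  occurrences : (ℕ → ℕ) → Filling → ℕ → ℕ
  occurrences top T v = ∑< C (columnOccurrences top T v)

  contentOf : ∀ m → (ℕ → ℕ) → Filling → Fin m → ℕ
  contentOf m top T u = occurrences top T (suc (toℕ u))

  record Admissible (m : ℕ) (top : ℕ → ℕ) (α : Fin m → ℕ) : Set where
    field
      total   : sum α ≡ ∑< C (height top)
      bounded : ∀ (S : Fin m → Bool) → (χ ∘ S) · α ≤ ∑< C (λ j → height top j ⊓ sum (χ ∘ S))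

  admissible-cong : ∀ {m top α β} → (∀ u → α u ≡ β u) → Admissible m top α → Admissible m top β
  admissible-cong α≗β admissible = record
    { total   = trans (sum-cong-≗ (sym ∘ α≗β)) total
    ; bounded = λ S → subst (_≤ _) (sum-cong-≗ (λ u → cong (χ (S u) *_) (α≗β u))) (bounded S)
    }
    where open Admissible admissible

  convexHull-admissible : ∀ {m top β} {S : (Fin m → ℕ) → Set} →
                          (∀ {α} → S α → Admissible m top α) → InConvexHull S β → Admissible m top β
  convexHull-admissible {m} {top} {β} admissible β∈hull = record { total = total ; bounded = bounded }
    where
    total : sum β ≡ ∑< C (height top)
    total = trans (sum-cong-≗ (λ v → sym (*-identityˡ (β v))))
      (·-≡-convexHull (λ _ → 1) _ (λ α α∈S → trans (sum-cong-≗ (λ v → *-identityˡ (α v)))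
                                                   (Admissible.total (admissible α∈S))) β∈hull)
    bounded : ∀ S → (χ ∘ S) · β ≤ ∑< C (λ j → height top j ⊓ sum (χ ∘ S))
    bounded S = ·-≤-convexHull (χ ∘ S) _ (λ α α∈S → Admissible.bounded (admissible α∈S) S) β∈hull

  module _ {m top T} (strict : ColumnStrict m top T) where
    open ColumnStrict strict

    column-increasing : ∀ {i i′ j} → InColumn top i j → i < i′ → i′ < bottom j → T i j < T i′ j
    column-increasing {i} {suc k} {j} c@(top≤i , _) i<sk sk<b with m≤n⇒m<n∨m≡n (s≤s⁻¹ i<sk)
    ... | inj₂ refl = cols c (≤-trans top≤i (n≤1+n i) , sk<b)
    ... | inj₁ i<k  = <-trans (column-increasing c i<k k<b)
                              (cols (≤-trans top≤i (<⇒≤ i<k) , k<b) (≤-trans top≤i (<⇒≤ i<sk) , sk<b))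
      where
      k<b : k < bottom j
      k<b = <-trans (n<1+n k) sk<b

    column-injective : ∀ {i i′ j} → InColumn top i j → InColumn top i′ j → T i j ≡ T i′ j → i ≡ i′
    column-injective {i} {i′} c c′ eq with <-cmp i i′
    ... | tri< i<i′ _ _ = ⊥-elim (<-irrefl eq (column-increasing c i<i′ (proj₂ c′)))
    ... | tri≈ _ i≡i′ _ = i≡i′
    ... | tri> _ _ i′<i = ⊥-elim (<-irrefl (sym eq) (column-increasing c′ i′<i (proj₂ c)))

    columnOccurrences≤1 : ∀ v j → columnOccurrences top T v j ≤ 1
    columnOccurrences≤1 v j = ∑<-𝟙-≤1 R (λ i → inColumn? top i j ×-dec T i j ≟ v)
      (λ (c , Tij≡v) (c′ , Ti′j≡v) → column-injective c c′ (trans Tij≡v (sym Ti′j≡v)))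

    values-in-cell : ∀ i j →
      ∑[ u < m ] 𝟙 (inColumn? top i j ×-dec T i j ≟ suc (toℕ u)) ≡ 𝟙 (inColumn? top i j)
    values-in-cell i j = by-cases (inColumn? top i j)
      where
      by-cases : (c? : Dec (InColumn top i j)) → ∑[ u < m ] 𝟙 (c? ×-dec T i j ≟ suc (toℕ u)) ≡ 𝟙 c?
      by-cases (yes c) = sum-𝟙-≟-suc-toℕ (T i j) (proj₁ (entries c)) (proj₂ (entries c))
      by-cases (no  _) = sum-replicate-zero m

    ∑-columnOccurrences : ∀ j → ∑[ u < m ] columnOccurrences top T (suc (toℕ u)) j ≡ height top j
    ∑-columnOccurrences j = begin
      ∑[ u < m ] ∑< R (λ i → 𝟙 (inColumn? top i j ×-dec T i j ≟ suc (toℕ u)))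
        ≡⟨ sum-∑<-comm {m} R (λ u i → 𝟙 (inColumn? top i j ×-dec T i j ≟ suc (toℕ u))) ⟩
      ∑< R (λ i → ∑[ u < m ] 𝟙 (inColumn? top i j ×-dec T i j ≟ suc (toℕ u)))
        ≡⟨ ∑<-cong R (λ i _ → values-in-cell i j) ⟩
      ∑< R (λ i → 𝟙 (inColumn? top i j))
        ≡⟨ ∑<-interval R (top j) (bottom j) (bottom≤R j) ⟩
      height top j ∎
      where open ≡-Reasoning

    content-admissible : Admissible m top (contentOf m top T)
    content-admissible = record { total = total ; bounded = bounded }
      where
      total : sum (contentOf m top T) ≡ ∑< C (height top)
      total = trans (sum-∑<-comm {m} C (λ u → columnOccurrences top T (suc (toℕ u))))
                    (∑<-cong C (λ j _ → ∑-columnOccurrences j))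

      bounded : ∀ S → (χ ∘ S) · contentOf m top T ≤ ∑< C (λ j → height top j ⊓ sum (χ ∘ S))
      bounded S = begin
        ∑[ u < m ] (χ (S u) * ∑< C (columnOccurrences top T (suc (toℕ u))))
          ≡⟨ sum-cong-≗ (λ u → *-distribˡ-∑< C (χ (S u)) (columnOccurrences top T (suc (toℕ u)))) ⟩
        ∑[ u < m ] ∑< C (λ j → χ (S u) * columnOccurrences top T (suc (toℕ u)) j)
          ≡⟨ sum-∑<-comm {m} C (λ u j → χ (S u) * columnOccurrences top T (suc (toℕ u)) j) ⟩
        ∑< C (λ j → ∑[ u < m ] (χ (S u) * columnOccurrences top T (suc (toℕ u)) j))
          ≤⟨ ∑<-mono-≤ C (λ j _ → ⊓-glb (≤height j) (≤size j)) ⟩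
        ∑< C (λ j → height top j ⊓ sum (χ ∘ S)) ∎
        where
        open ≤-Reasoning
        ≤height : ∀ j → ∑[ u < m ] (χ (S u) * columnOccurrences top T (suc (toℕ u)) j) ≤ height top j
        ≤height j = ≤-trans
          (sum-mono-≤ (λ u → ≤-trans (*-monoˡ-≤ _ (χ≤1 (S u))) (≤-reflexive (*-identityˡ _))))
          (≤-reflexive (∑-columnOccurrences j))
        ≤size : ∀ j → ∑[ u < m ] (χ (S u) * columnOccurrences top T (suc (toℕ u)) j) ≤ sum (χ ∘ S)
        ≤size j = sum-mono-≤ (λ u → ≤-trans (*-monoʳ-≤ (χ (S u)) (columnOccurrences≤1 _ j))
                                            (≤-reflexive (*-identityʳ _)))

  module ColumnsOfOnes (top : ℕ → ℕ) where

    -- Putting the ones into the tallest columns keeps the remaining content admissible;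
    -- breaking ties to the left keeps the new upper boundary antitone.
    Chosen : ℕ → ℕ → ℕ → Set
    Chosen t p j = t < height top j ⊎ (height top j ≡ t × j < p)

    chosen? : ∀ t p j → Dec (Chosen t p j)
    chosen? t p j = t <? height top j ⊎-dec (height top j ≟ t ×-dec j <? p)

    nChosen : ℕ → ℕ → ℕ
    nChosen t p = ∑< C (𝟙 ∘ chosen? t p)

    nTall : ℕ → ℕ
    nTall t = ∑< C (λ j → 𝟙 (t ≤? height top j))

    chosen⇒≤height : ∀ {t p j} → Chosen t p j → t ≤ height top j
    chosen⇒≤height (inj₁ t<h)       = <⇒≤ t<h
    chosen⇒≤height (inj₂ (h≡t , _)) = ≤-reflexive (sym h≡t)

    chosen-anti : ∀ {t p j} → height top (suc j) ≤ height top j → Chosen t p (suc j) → Chosen t p j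
    chosen-anti h′≤h (inj₁ t<h′) = inj₁ (<-≤-trans t<h′ h′≤h)
    chosen-anti {t} {p} {j} h′≤h (inj₂ (h′≡t , 1+j<p)) with t <? height top j
    ... | yes t<h = inj₁ t<h
    ... | no  t≮h =
      inj₂ (≤-antisym (≮⇒≥ t≮h) (subst (_≤ height top j) h′≡t h′≤h) , <-trans (n<1+n j) 1+j<p)

    nChosen-none : ∀ t → nChosen t 0 ≡ nTall (suc t)
    nChosen-none t = ∑<-cong C (λ j _ →
      𝟙-cong (λ { (inj₁ t<h) → t<h ; (inj₂ (_ , ())) }) inj₁ (chosen? t 0 j) (suc t ≤? height top j))

    nChosen-all : ∀ t → nChosen t C ≡ nTall t
    nChosen-all t = ∑<-cong C (λ j j<C →
      𝟙-cong chosen⇒≤height (≤⇒chosen j<C) (chosen? t C j) (t ≤? height top j))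
      where
      ≤⇒chosen : ∀ {j} → j < C → t ≤ height top j → Chosen t C j
      ≤⇒chosen j<C t≤h with m≤n⇒m<n∨m≡n t≤h
      ... | inj₁ t<h = inj₁ t<h
      ... | inj₂ t≡h = inj₂ (sym t≡h , j<C)

    nChosen-step : ∀ t p → nChosen t (suc p) ≤ suc (nChosen t p)
    nChosen-step t p = begin
      ∑< C (𝟙 ∘ chosen? t (suc p))                ≤⟨ ∑<-mono-≤ C (λ j _ → one-more j) ⟩
      ∑< C (λ j → 𝟙 (chosen? t p j) + 𝟙 (j ≟ p))  ≡⟨ ∑<-distrib-+ C (𝟙 ∘ chosen? t p) (λ j → 𝟙 (j ≟ p)) ⟩
      nChosen t p + ∑< C (λ j → 𝟙 (j ≟ p))        ≤⟨ +-monoʳ-≤ (nChosen t p) (∑<-𝟙-≤1 C (_≟ p) unique) ⟩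
      nChosen t p + 1                             ≡⟨ +-comm (nChosen t p) 1 ⟩
      suc (nChosen t p)                           ∎
      where
      open ≤-Reasoning
      chosen-suc : ∀ {j} → Chosen t (suc p) j → Chosen t p j ⊎ j ≡ p
      chosen-suc (inj₁ t<h) = inj₁ (inj₁ t<h)
      chosen-suc (inj₂ (h≡t , j<1+p)) with m<1+n⇒m<n∨m≡n j<1+p
      ... | inj₁ j<p = inj₁ (inj₂ (h≡t , j<p))
      ... | inj₂ j≡p = inj₂ j≡p
      unique : ∀ {i j} → i ≡ p → j ≡ p → i ≡ j
      unique i≡p j≡p = trans i≡p (sym j≡p)
      one-more : ∀ j → 𝟙 (chosen? t (suc p) j) ≤ 𝟙 (chosen? t p j) + 𝟙 (j ≟ p)
      one-more j = ≤-trans (𝟙-mono chosen-suc (chosen? t (suc p) j) (chosen? t p j ⊎-dec j ≟ p))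
                           (𝟙-⊎≤ (chosen? t p j) (j ≟ p))

    nTall-anti : ∀ t → nTall (suc t) ≤ nTall t
    nTall-anti t = ∑<-mono-≤ C (λ j _ → 𝟙-mono <⇒≤ (suc t ≤? height top j) (t ≤? height top j))

    nTall-vanishes : ∀ {t} → R < t → nTall t ≡ 0
    nTall-vanishes {t} R<t = ∑<-zero C (λ j _ → 𝟙-no (t ≤? height top j)
      (λ t≤h → <⇒≱ R<t (≤-trans t≤h (≤-trans (m∸n≤m (bottom j) (top j)) (bottom≤R j)))))

    nonempty≡nTall1 : ∑< C (λ j → height top j ⊓ 1) ≡ nTall 1
    nonempty≡nTall1 = ∑<-cong C (λ j _ → ⊓1≡𝟙 (height top j))
      where
      ⊓1≡𝟙 : ∀ h → h ⊓ 1 ≡ 𝟙 (1 ≤? h)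
      ⊓1≡𝟙 zero    = refl
      ⊓1≡𝟙 (suc h) = cong suc (⊓-zeroʳ h)

    choose : ∀ {a} → a ≤ ∑< C (λ j → height top j ⊓ 1) → ∃₂ λ t p → 1 ≤ t × nChosen t p ≡ a
    choose {a} a≤nonempty
      with antitone-crossing nTall nTall-anti R (subst (a ≤_) nonempty≡nTall1 a≤nonempty)
             (≤-trans (≤-reflexive (nTall-vanishes (m<m+n R z<s))) z≤n)
    ... | t , 1≤t , a≤nTall , nTall≤a
      with stepwise-intermediate-value (nChosen t) (nChosen-step t) C
             (subst (_≤ a) (sym (nChosen-none t)) nTall≤a) (subst (a ≤_) (sym (nChosen-all t)) a≤nTall)
    ...   | p , nChosen≡a = t , p , 1≤t , nChosen≡a

  module Peel {m} (top : ℕ → ℕ)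
              (top-anti : ∀ j → top (suc j) ≤ top j) (top≤bottom : ∀ j → top j ≤ bottom j)
              {α : Fin (suc m) → ℕ} (admissible : Admissible (suc m) top α)
              (t p : ℕ) (1≤t : 1 ≤ t) (nChosen≡ : ColumnsOfOnes.nChosen top t p ≡ α zero) where

    open ColumnsOfOnes top
    open Admissible admissible

    top⁺ : ℕ → ℕ
    top⁺ j = top j + 𝟙 (chosen? t p j)

    top⁺-anti : ∀ j → top⁺ (suc j) ≤ top⁺ j
    top⁺-anti j with m≤n⇒m<n∨m≡n (top-anti j)
    ... | inj₁ top′<top = begin
      top (suc j) + 𝟙 (chosen? t p (suc j))   ≤⟨ +-monoʳ-≤ (top (suc j)) (𝟙≤1 (chosen? t p (suc j))) ⟩
      top (suc j) + 1                         ≡⟨ +-comm (top (suc j)) 1 ⟩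
      suc (top (suc j))                       ≤⟨ top′<top ⟩
      top j                                   ≤⟨ m≤m+n (top j) _ ⟩
      top⁺ j                                  ∎
      where open ≤-Reasoning
    ... | inj₂ top′≡top = +-mono-≤ (≤-reflexive top′≡top)
      (𝟙-mono (chosen-anti height-anti) (chosen? t p (suc j)) (chosen? t p j))
      where
      height-anti : height top (suc j) ≤ height top j
      height-anti = subst (λ x → bottom (suc j) ∸ x ≤ height top j) (sym top′≡top)
                          (∸-monoˡ-≤ (top j) (bottom-anti j))

    𝟙chosen≤height : ∀ j → 𝟙 (chosen? t p j) ≤ height top j
    𝟙chosen≤height j = 𝟙-≤ (λ c → ≤-trans 1≤t (chosen⇒≤height c)) (chosen? t p j)

    top⁺≤bottom : ∀ j → top⁺ j ≤ bottom j
    top⁺≤bottom j =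
      ≤-trans (+-monoʳ-≤ (top j) (𝟙chosen≤height j)) (≤-reflexive (m+[n∸m]≡n (top≤bottom j)))

    top⁺≤suc : ∀ {i j} → top j ≤ i → top⁺ j ≤ suc i
    top⁺≤suc {i} {j} top≤i = begin
      top j + 𝟙 (chosen? t p j)   ≤⟨ +-mono-≤ top≤i (𝟙≤1 (chosen? t p j)) ⟩
      i + 1                       ≡⟨ +-comm i 1 ⟩
      suc i                       ∎
      where open ≤-Reasoning

    height-top⁺ : ∀ j → height top⁺ j ≡ height top j ∸ 𝟙 (chosen? t p j)
    height-top⁺ j = sym (∸-+-assoc (bottom j) (top j) (𝟙 (chosen? t p j)))

    height-split : ∀ j → height top j ≡ height top⁺ j + 𝟙 (chosen? t p j)
    height-split j =
      sym (trans (cong (_+ 𝟙 (chosen? t p j)) (height-top⁺ j)) (m∸n+n≡m (𝟙chosen≤height j)))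

    ⊓-split-≥ : ∀ {k} → t ≤ k → ∀ j → height top j ⊓ suc k ≡ height top⁺ j ⊓ k + 𝟙 (chosen? t p j)
    ⊓-split-≥ {k} t≤k j rewrite height-top⁺ j = split (chosen? t p j)
      where
      split : (c? : Dec (Chosen t p j)) → height top j ⊓ suc k ≡ (height top j ∸ 𝟙 c?) ⊓ k + 𝟙 c?
      split (yes c) = ⊓-suc-pred k (≤-trans 1≤t (chosen⇒≤height c))
      split (no ¬c) = trans (m≤n⇒m⊓n≡m (m≤n⇒m≤1+n h≤k)) (sym (trans (+-identityʳ _) (m≤n⇒m⊓n≡m h≤k)))
        where
        h≤k : height top j ≤ k
        h≤k = ≤-trans (≮⇒≥ (¬c ∘ inj₁)) t≤k

    ⊓-split-< : ∀ {k} → k < t → ∀ j → height top j ⊓ k ≡ height top⁺ j ⊓ k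
    ⊓-split-< {k} k<t j rewrite height-top⁺ j = split (chosen? t p j)
      where
      split : (c? : Dec (Chosen t p j)) → height top j ⊓ k ≡ (height top j ∸ 𝟙 c?) ⊓ k
      split (yes c) = ⊓-pred (<-≤-trans k<t (chosen⇒≤height c))
      split (no  _) = refl

    admissible⁺ : Admissible m top⁺ (α ∘ suc)
    admissible⁺ = record { total = total⁺ ; bounded = bounded⁺ }
      where
      total⁺ : sum (α ∘ suc) ≡ ∑< C (height top⁺)
      total⁺ = +-cancelˡ-≡ (α zero) _ _ (begin
        α zero + sum (α ∘ suc)                          ≡⟨ total ⟩
        ∑< C (height top)                               ≡⟨ ∑<-cong C (λ j _ → height-split j) ⟩
        ∑< C (λ j → height top⁺ j + 𝟙 (chosen? t p j))  ≡⟨ ∑<-distrib-+ C (height top⁺) (𝟙 ∘ chosen? t p) ⟩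
        ∑< C (height top⁺) + nChosen t p                ≡⟨ cong (∑< C (height top⁺) +_) nChosen≡ ⟩
        ∑< C (height top⁺) + α zero                     ≡⟨ +-comm _ (α zero) ⟩
        α zero + ∑< C (height top⁺)                     ∎)
        where open ≡-Reasoning

      bounded⁺ : ∀ S → (χ ∘ S) · (α ∘ suc) ≤ ∑< C (λ j → height top⁺ j ⊓ sum (χ ∘ S))
      bounded⁺ S with t ≤? sum (χ ∘ S)
      ... | yes t≤k = +-cancelˡ-≤ (α zero) _ _ (begin
        α zero + (χ ∘ S) · (α ∘ suc)
          ≡⟨ cong (_+ (χ ∘ S) · (α ∘ suc)) (*-identityˡ (α zero)) ⟨
        (χ ∘ (true Vector.∷ S)) · α
          ≤⟨ bounded (true Vector.∷ S) ⟩
        ∑< C (λ j → height top j ⊓ suc k)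
          ≡⟨ ∑<-cong C (λ j _ → ⊓-split-≥ t≤k j) ⟩
        ∑< C (λ j → height top⁺ j ⊓ k + 𝟙 (chosen? t p j))
          ≡⟨ ∑<-distrib-+ C (λ j → height top⁺ j ⊓ k) (𝟙 ∘ chosen? t p) ⟩
        ∑< C (λ j → height top⁺ j ⊓ k) + nChosen t p
          ≡⟨ cong (∑< C (λ j → height top⁺ j ⊓ k) +_) nChosen≡ ⟩
        ∑< C (λ j → height top⁺ j ⊓ k) + α zero
          ≡⟨ +-comm _ (α zero) ⟩
        α zero + ∑< C (λ j → height top⁺ j ⊓ k) ∎)
        where
        open ≤-Reasoning
        k = sum (χ ∘ S)
      ... | no t≰k = begin
        (χ ∘ S) · (α ∘ suc)                       ≤⟨ bounded (false Vector.∷ S) ⟩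
        ∑< C (λ j → height top j ⊓ k)             ≡⟨ ∑<-cong C (λ j _ → ⊓-split-< (≰⇒> t≰k) j) ⟩
        ∑< C (λ j → height top⁺ j ⊓ k)            ∎
        where
        open ≤-Reasoning
        k = sum (χ ∘ S)

    module Fill {T′ : Filling} (strict′ : ColumnStrict m top⁺ T′)
                (content′ : ∀ u → contentOf m top⁺ T′ u ≡ α (suc u)) where

      open ColumnStrict strict′ renaming (entries to entries′; rows to rows′; cols to cols′)

      T : Filling
      T i j = if does (i <? top⁺ j) then 1 else suc (T′ i j)

      T-above : ∀ {i j} → i < top⁺ j → T i j ≡ 1
      T-above {i} {j} i<top⁺ = cong (if_then 1 else suc (T′ i j)) (dec-true (i <? top⁺ j) i<top⁺)

      T-below : ∀ {i j} → top⁺ j ≤ i → T i j ≡ suc (T′ i j)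
      T-below {i} {j} top⁺≤i = cong (if_then 1 else suc (T′ i j)) (dec-false (i <? top⁺ j) (≤⇒≯ top⁺≤i))

      T-strict : ColumnStrict (suc m) top T
      T-strict = record { entries = entries ; rows = rows ; cols = cols }
        where
        entries : ∀ {i j} → InColumn top i j → 1 ≤ T i j × T i j ≤ suc m
        entries {i} {j} (_ , i<b) with i <? top⁺ j
        ... | yes i<top⁺ rewrite T-above i<top⁺ = ≤-refl , s≤s z≤n
        ... | no  i≮top⁺ rewrite T-below (≮⇒≥ i≮top⁺) =
          s≤s z≤n , s≤s (proj₂ (entries′ (≮⇒≥ i≮top⁺ , i<b)))

        rows : ∀ {i j} → InColumn top i j → InColumn top i (suc j) → T i j ≤ T i (suc j)
        rows {i} {j} (_ , i<b) c′ with i <? top⁺ j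
        ... | yes i<top⁺ rewrite T-above i<top⁺ = proj₁ (entries c′)
        ... | no  i≮top⁺ = below (≮⇒≥ i≮top⁺) (≤-trans (top⁺-anti j) (≮⇒≥ i≮top⁺))
          where
          below : top⁺ j ≤ i → top⁺ (suc j) ≤ i → T i j ≤ T i (suc j)
          below top⁺≤i top⁺′≤i rewrite T-below top⁺≤i | T-below top⁺′≤i =
            s≤s (rows′ (top⁺≤i , i<b) (top⁺′≤i , proj₂ c′))

        cols : ∀ {i j} → InColumn top i j → InColumn top (suc i) j → T i j < T (suc i) j
        cols {i} {j} (top≤i , i<b) (_ , 1+i<b) rewrite T-below (top⁺≤suc top≤i) with i <? top⁺ j
        ... | yes i<top⁺ rewrite T-above i<top⁺ = s≤s (proj₁ (entries′ (top⁺≤suc top≤i , 1+i<b)))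
        ... | no  i≮top⁺ rewrite T-below (≮⇒≥ i≮top⁺) =
          s≤s (cols′ (≮⇒≥ i≮top⁺ , i<b) (top⁺≤suc top≤i , 1+i<b))

      ones : ∀ {i j} → InColumn top i j × T i j ≡ 1 → top j ≤ i × i < top⁺ j
      ones {i} {j} ((top≤i , i<b) , Tij≡1) with i <? top⁺ j
      ... | yes i<top⁺ = top≤i , i<top⁺
      ... | no  i≮top⁺ = ⊥-elim (<-irrefl
        (sym (suc-injective (trans (sym (T-below (≮⇒≥ i≮top⁺))) Tij≡1)))
        (proj₁ (entries′ (≮⇒≥ i≮top⁺ , i<b))))

      ones⁻¹ : ∀ {i j} → top j ≤ i × i < top⁺ j → InColumn top i j × T i j ≡ 1
      ones⁻¹ {i} {j} (top≤i , i<top⁺) = (top≤i , <-≤-trans i<top⁺ (top⁺≤bottom j)) , T-above i<top⁺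

      shifted : ∀ {i j w} → InColumn top i j × T i j ≡ suc (suc w) → InColumn top⁺ i j × T′ i j ≡ suc w
      shifted {i} {j} ((_ , i<b) , Tij≡) with i <? top⁺ j
      ... | yes i<top⁺ = ⊥-elim (0≢1+n (suc-injective (trans (sym (T-above i<top⁺)) Tij≡)))
      ... | no  i≮top⁺ = (≮⇒≥ i≮top⁺ , i<b) , suc-injective (trans (sym (T-below (≮⇒≥ i≮top⁺))) Tij≡)

      shifted⁻¹ : ∀ {i j w} → InColumn top⁺ i j × T′ i j ≡ suc w → InColumn top i j × T i j ≡ suc (suc w)
      shifted⁻¹ {i} {j} ((top⁺≤i , i<b) , T′ij≡) =
        (≤-trans (m≤m+n (top j) _) top⁺≤i , i<b) , trans (T-below top⁺≤i) (cong suc T′ij≡)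

      T-content : ∀ u → contentOf (suc m) top T u ≡ α u
      T-content zero = trans (∑<-cong C (λ j _ → ones-in-column j)) nChosen≡
        where
        ones-in-column : ∀ j → columnOccurrences top T 1 j ≡ 𝟙 (chosen? t p j)
        ones-in-column j = begin
          ∑< R (λ i → 𝟙 (inColumn? top i j ×-dec T i j ≟ 1))
            ≡⟨ ∑<-cong R (λ i _ → 𝟙-cong ones ones⁻¹ (inColumn? top i j ×-dec T i j ≟ 1)
                                                     (top j ≤? i ×-dec i <? top⁺ j)) ⟩
          ∑< R (λ i → 𝟙 (top j ≤? i ×-dec i <? top⁺ j))
            ≡⟨ ∑<-interval R (top j) (top⁺ j) (≤-trans (top⁺≤bottom j) (bottom≤R j)) ⟩
          top⁺ j ∸ top j
            ≡⟨ m+n∸m≡n (top j) _ ⟩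
          𝟙 (chosen? t p j) ∎
          where open ≡-Reasoning
      T-content (suc u) = trans (∑<-cong C (λ j _ → ∑<-cong R (λ i _ →
        𝟙-cong shifted shifted⁻¹ (inColumn? top i j ×-dec T i j ≟ suc (suc (toℕ u)))
                                 (inColumn? top⁺ i j ×-dec T′ i j ≟ suc (toℕ u)))))
        (content′ u)

  Realisation : ∀ m → (ℕ → ℕ) → (Fin m → ℕ) → Set
  Realisation m top α = Σ Filling λ T → ColumnStrict m top T × (∀ u → contentOf m top T u ≡ α u)

  no-cells : ∀ {top} → ∑< C (height top) ≡ 0 → ∀ {i j} → ¬ InColumn top i j
  no-cells {top} ∑height≡0 {i} {j} (top≤i , i<b) with j <? C
  ... | yes j<C = <-irrefl refl (<-≤-trans i<b (≤-trans (m∸n≡0⇒m≤n (∑<≡0⇒ C ∑height≡0 j<C)) top≤i))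
  ... | no  j≮C = n≮0 (subst (i <_) (bottom-beyond (≮⇒≥ j≮C)) i<b)

  admissible⇒realisable : ∀ m {top} → (∀ j → top (suc j) ≤ top j) → (∀ j → top j ≤ bottom j) →
                          ∀ {α} → Admissible m top α → Realisation m top α
  admissible⇒realisable zero {top} top-anti top≤bottom admissible =
    (λ _ _ → 0) ,
    record { entries = ⊥-elim ∘ empty ; rows = ⊥-elim ∘ empty ; cols = ⊥-elim ∘ empty } ,
    λ ()
    where
    empty : ∀ {i j} → ¬ InColumn top i j
    empty = no-cells {top} (sym (Admissible.total admissible))
  admissible⇒realisable (suc m) {top} top-anti top≤bottom {α} admissible =
    peel (ColumnsOfOnes.choose top ones≤nonempty)
    where
    open Admissible admissible

    ones≤nonempty : α zero ≤ ∑< C (λ j → height top j ⊓ 1)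
    ones≤nonempty = begin
      α zero
        ≡⟨ *-identityˡ (α zero) ⟨
      1 * α zero
        ≤⟨ m≤m+n (1 * α zero) _ ⟩
      (χ ∘ (true Vector.∷ λ _ → false)) · α
        ≤⟨ bounded (true Vector.∷ λ _ → false) ⟩
      ∑< C (λ j → height top j ⊓ suc (sum {m} (λ _ → 0)))
        ≡⟨ cong (λ s → ∑< C (λ j → height top j ⊓ suc s)) (sum-replicate-zero m) ⟩
      ∑< C (λ j → height top j ⊓ 1) ∎
      where open ≤-Reasoning

    peel : (∃₂ λ t p → 1 ≤ t × ColumnsOfOnes.nChosen top t p ≡ α zero) → Realisation (suc m) top α
    peel (t , p , 1≤t , nChosen≡) = fill (admissible⇒realisable m top⁺-anti top⁺≤bottom admissible⁺)
      where
      open Peel top top-anti top≤bottom admissible t p 1≤t nChosen≡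
      fill : Realisation m top⁺ (α ∘ suc) → Realisation (suc m) top α
      fill (_ , strict′ , content′) = T , T-strict , T-content
        where open Fill strict′ content′

-- Skew shapes

module SkewShape (λ′ μ : List ℕ) (λ-partition : IsPartition λ′) (μ-partition : IsPartition μ)
                 (μ⊆λ : μ ⊆ₚ λ′) where

  λ-decreasing : Decreasing λ′
  λ-decreasing = decreasing (proj₂ λ-partition)

  μ-decreasing : Decreasing μ
  μ-decreasing = decreasing (proj₂ μ-partition)

  open ColumnShape (conjugate λ′) (length λ′) (part λ′ 0)
                   (conjugate-anti λ-decreasing) (conjugate≤length λ′) (conjugate-beyond λ-decreasing)
    public

  top : ℕ → ℕ
  top = conjugate μ

  toColumn : ∀ {i j} → InSkew λ′ μ i j → InColumn top i j
  toColumn (μᵢ≤j , j<λᵢ) =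
    ≮⇒≥ (λ i<top → <⇒≱ (<conjugate⇒<part μ-decreasing i<top) μᵢ≤j) , <part⇒<conjugate λ-decreasing j<λᵢ

  fromColumn : ∀ {i j} → InColumn top i j → InSkew λ′ μ i j
  fromColumn (top≤i , i<bottom) =
    ≮⇒≥ (λ j<μᵢ → <⇒≱ (<part⇒<conjugate μ-decreasing j<μᵢ) top≤i) ,
    <conjugate⇒<part λ-decreasing i<bottom

  multiplicity≡occurrences : ∀ T k → multiplicity λ′ μ T k ≡ occurrences top T k
  multiplicity≡occurrences T k = begin
    length (filter isK? (cells λ′ μ))
      ≡⟨ length-filter-concatMap-applyUpTo isK? row id (length λ′) ⟩
    ∑< (length λ′) (λ i → length (filter isK? (row i)))
      ≡⟨ ∑<-cong (length λ′) (λ i _ → trans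
           (length-filter-map isK? (i ,_) (filter (part μ i ≤?_) (applyUpTo id (part λ′ i))))
           (length-filter-filter-applyUpTo (part μ i ≤?_) (λ j → T i j ≟ k) id (part λ′ i))) ⟩
    ∑< (length λ′) (λ i → ∑< (part λ′ i) (λ j → 𝟙 (part μ i ≤? j ×-dec T i j ≟ k)))
      ≡⟨ ∑<-cong (length λ′) (λ i _ → ∑<-extend (part λ′ i) (part λ′ 0) _ (part≤head λ-decreasing i)) ⟩
    ∑< (length λ′) (λ i → ∑< (part λ′ 0) (λ j → 𝟙 (j <? part λ′ i) * 𝟙 (part μ i ≤? j ×-dec T i j ≟ k)))
      ≡⟨ ∑<-comm (length λ′) (part λ′ 0) _ ⟩
    ∑< (part λ′ 0) (λ j → ∑< (length λ′) (λ i → 𝟙 (j <? part λ′ i) * 𝟙 (part μ i ≤? j ×-dec T i j ≟ k)))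
      ≡⟨ ∑<-cong (part λ′ 0) (λ j _ → ∑<-cong (length λ′) (λ i _ → cell-indicator i j)) ⟩
    occurrences top T k ∎
    where
    open ≡-Reasoning
    isK? : (c : ℕ × ℕ) → Dec (T (proj₁ c) (proj₂ c) ≡ k)
    isK? (i , j) = T i j ≟ k
    row : ℕ → List (ℕ × ℕ)
    row i = map (i ,_) (filter (part μ i ≤?_) (applyUpTo id (part λ′ i)))
    cell-indicator : ∀ i j → 𝟙 (j <? part λ′ i) * 𝟙 (part μ i ≤? j ×-dec T i j ≟ k)
                           ≡ 𝟙 (inColumn? top i j ×-dec T i j ≟ k)
    cell-indicator i j = trans (sym (𝟙-× (j <? part λ′ i) (part μ i ≤? j ×-dec T i j ≟ k)))
      (𝟙-cong (λ (j<λᵢ , μᵢ≤j , Tij≡k) → toColumn (μᵢ≤j , j<λᵢ) , Tij≡k)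
              (λ (c , Tij≡k) → let (μᵢ≤j , j<λᵢ) = fromColumn c in j<λᵢ , μᵢ≤j , Tij≡k)
              (j <? part λ′ i ×-dec (part μ i ≤? j ×-dec T i j ≟ k)) (inColumn? top i j ×-dec T i j ≟ k))

  ssyt⇒columnStrict : ∀ {m T} → IsSSYT m λ′ μ T → ColumnStrict m top T
  ssyt⇒columnStrict ssyt = record
    { entries = λ c → IsSSYT.entries ssyt _ _ (fromColumn c)
    ; rows    = λ c c′ → IsSSYT.rows ssyt _ _ (fromColumn c) (fromColumn c′)
    ; cols    = λ c c′ → IsSSYT.cols ssyt _ _ (fromColumn c) (fromColumn c′)
    }

  columnStrict⇒ssyt : ∀ {m T} → ColumnStrict m top T → IsSSYT m λ′ μ T
  columnStrict⇒ssyt strict = record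
    { entries = λ _ _ s → ColumnStrict.entries strict (toColumn s)
    ; rows    = λ _ _ s s′ → ColumnStrict.rows strict (toColumn s) (toColumn s′)
    ; cols    = λ _ _ s s′ → ColumnStrict.cols strict (toColumn s) (toColumn s′)
    }

  inSupport⇒admissible : ∀ {m α} → InSupport m λ′ μ α → Admissible m top α
  inSupport⇒admissible (T , ssyt , content≡α) =
    admissible-cong (λ u → trans (sym (multiplicity≡occurrences T _)) (content≡α u))
                    (content-admissible (ssyt⇒columnStrict ssyt))

  admissible⇒inSupport : ∀ {m α} → Admissible m top α → InSupport m λ′ μ α
  admissible⇒inSupport {m} admissible with admissible⇒realisable m (conjugate-anti μ-decreasing)
                                             (conjugate-mono-⊆ μ-decreasing λ-decreasing μ⊆λ) admissible
  ... | T , strict , contentOf≡α =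
    T , columnStrict⇒ssyt strict , λ u → trans (multiplicity≡occurrences T _) (contentOf≡α u)

corollary5p10 : (λ′ μ : List ℕ) → IsPartition λ′ → IsPartition μ → μ ⊆ₚ λ′
    → SkewSchurSNP λ′ μ
corollary5p10 λ′ μ λ-partition μ-partition μ⊆λ m _ β β∈hull =
  admissible⇒inSupport (convexHull-admissible inSupport⇒admissible β∈hull)
  where open SkewShape λ′ μ λ-partition μ-partition μ⊆λ
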